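{- Let $(\mathcal{E},\mathcal{M})$ be a modal category and let $\iota_A:A\hookrightarrow A+B$, $\iota_B:B\hookrightarrow A+B$ be a disjoint union of objects $A,B$. Then $\iota_A$ and $\iota_B$ are open, i.e. $\iota_A^*\Diamond S=\Diamond\iota_A^*S$ and $\iota_B^*\Diamond S=\Diamond\iota_B^*S$ for every $S\in\mathrm{Sub}_{\mathcal{M}}(A+B)$.
   Context: An f-coherent category is a pair $(\mathcal{E},\mathcal{M})$ where $\mathcal{E}$ has finite limits and $\mathcal{M}$ is a class of monomorphisms containing all isomorphisms and regular monomorphisms, closed under composition and pullback, such that every arrow factors as $m\circ e$ with $m\in\mathcal{M}$ and $e$ left orthogonal to all of $\mathcal{M}$, these left-orthogonal arrows being pullback-stable, and such that each poset $\mathrm{Sub}_{\mathcal{M}}(X)$ of $\mathcal{M}$-subobjects has finite joins preserved by pullback $f^*$; $\exists_f$ denotes the left adjoint of $f^*$. A modal category is such a category with operators $\Diamond=\Diamond_X$ on each $\mathrm{Sub}_{\mathcal{M}}(X)$ preserving finite joins, such that $\Diamond_Xf^*S\le f^*\Diamond_YS$ for all $f:X\to Y$, and $\Diamond_A\iota^*S=\iota^*\Diamond_X\exists_\iota\iota^*S$ for every $\iota:A\hookrightarrow X$ in $\mathcal{M}$ and $S\in\mathrm{Sub}_{\mathcal{M}}(X)$. A disjoint union of $A,B$ is an object $A+B$ with $\mathcal{M}$-subobjects $\iota_A:A\hookrightarrow A+B$, $\iota_B:B\hookrightarrow A+B$ which are Boolean complements of each other in $\mathrm{Sub}_{\mathcal{M}}(A+B)$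 (meet $\bot$, join $\top$) and satisfy $\Diamond A\le A$ and $\Diamond B\le B$, with $\Diamond$ computed in $\mathrm{Sub}_{\mathcal{M}}(A+B)$. -}

module Defs where

open import Level using (Level; _⊔_) renaming (suc to lsuc)
open import Relation.Binary.PropositionalEquality using (_≡_)
open import Data.Product using (Σ; _×_; _,_; Σ-syntax)

record Category (o h : Level) : Set (lsuc (o ⊔ h)) where
  infixr 9 _∘_
  field
    Obj       : Set o
    Hom       : Obj → Obj → Set h
    id        : ∀ {A} → Hom A A
    _∘_       : ∀ {A B C} → Hom B C → Hom A B → Hom A C
    identityˡ : ∀ {A B} {f : Hom A B} → id ∘ f ≡ f
    identityʳ : ∀ {A B} {f : Hom A B} → f ∘ id ≡ f
    assoc     : ∀ {A B C D} {f : Hom A B} {g : Hom B C} {k : Hom C D} →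
                (k ∘ g) ∘ f ≡ k ∘ (g ∘ f)

module Notions {o h : Level} (C : Category o h) where
  open Category C

  Mono : ∀ {A B} → Hom A B → Set (o ⊔ h)
  Mono {A} f = ∀ {Z} (g k : Hom Z A) → f ∘ g ≡ f ∘ k → g ≡ k

  IsIso : ∀ {A B} → Hom A B → Set h
  IsIso {A} {B} f = Σ[ g ∈ Hom B A ] (g ∘ f ≡ id × f ∘ g ≡ id)

  record IsTerminal (T : Obj) : Set (o ⊔ h) where
    field
      !        : ∀ {X} → Hom X T
      !-unique : ∀ {X} (f : Hom X T) → f ≡ !

  record IsPullback {X Y Z P : Obj} (f : Hom X Z) (g : Hom Y Z)
                    (p₁ : Hom P X) (p₂ : Hom P Y) : Set (o ⊔ h) where
    field
      commute   : f ∘ p₁ ≡ g ∘ p₂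
      universal : ∀ {Q} (q₁ : Hom Q X) (q₂ : Hom Q Y) → f ∘ q₁ ≡ g ∘ q₂ →
                  Σ[ u ∈ Hom Q P ] ((p₁ ∘ u ≡ q₁ × p₂ ∘ u ≡ q₂) ×
                    (∀ (v : Hom Q P) → p₁ ∘ v ≡ q₁ → p₂ ∘ v ≡ q₂ → v ≡ u))

  record Pullback {X Y Z : Obj} (f : Hom X Z) (g : Hom Y Z) : Set (o ⊔ h) where
    field
      P          : Obj
      p₁         : Hom P X
      p₂         : Hom P Y
      isPullback : IsPullback f g p₁ p₂

  record IsEqualizer {E A B : Obj} (e : Hom E A) (f g : Hom A B) : Set (o ⊔ h) where
    field
      equalize  : f ∘ e ≡ g ∘ e
      universal : ∀ {Q} (q : Hom Q A) → f ∘ q ≡ g ∘ q →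
                  Σ[ u ∈ Hom Q E ] (e ∘ u ≡ q × (∀ (v : Hom Q E) → e ∘ v ≡ q → v ≡ u))

  RegularMono : ∀ {E A} → Hom E A → Set (o ⊔ h)
  RegularMono {E} {A} e = Σ[ B ∈ Obj ] Σ[ f ∈ Hom A B ] Σ[ g ∈ Hom A B ] IsEqualizer e f g

  LeftOrth : ∀ {A B C' D} → Hom A B → Hom C' D → Set h
  LeftOrth {A} {B} {C'} {D} e m =
    ∀ (u : Hom A C') (v : Hom B D) → m ∘ u ≡ v ∘ e →
    Σ[ d ∈ Hom B C' ] ((d ∘ e ≡ u × m ∘ d ≡ v) ×
      (∀ (d' : Hom B C') → d' ∘ e ≡ u → m ∘ d' ≡ v → d' ≡ d))

  record FinitelyComplete : Set (o ⊔ h) where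
    field
      ⊤          : Obj
      ⊤-terminal : IsTerminal ⊤
      pullback   : ∀ {X Y Z} (f : Hom X Z) (g : Hom Y Z) → Pullback f g

  MorClass : (ℓ : Level) → Set (o ⊔ h ⊔ lsuc ℓ)
  MorClass ℓ = ∀ {A B} → Hom A B → Set ℓ

  LeftOrthClass : ∀ {ℓ} → MorClass ℓ → ∀ {A B} → Hom A B → Set (o ⊔ h ⊔ ℓ)
  LeftOrthClass M e = ∀ {C' D} (m : Hom C' D) → M m → LeftOrth e m

  PullbackStable : ∀ {ℓ} → MorClass ℓ → Set (o ⊔ h ⊔ ℓ)
  PullbackStable M = ∀ {X Y Z P} {f : Hom X Z} {m : Hom Y Z} {p₁ : Hom P X} {p₂ : Hom P Y} →
                     IsPullback f m p₁ p₂ → M m → M p₁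

module SubM {o h ℓ : Level} (C : Category o h) (M : Notions.MorClass C ℓ) where
  open Category C
  open Notions C

  record Sub (X : Obj) : Set (o ⊔ h ⊔ ℓ) where
    constructor sub
    field
      dom : Obj
      arr : Hom dom X
      inM : M arr
  open Sub public

  infix 4 _≤_ _≅_
  _≤_ : ∀ {X} → Sub X → Sub X → Set h
  S ≤ T = Σ[ k ∈ Hom (dom S) (dom T) ] arr T ∘ k ≡ arr S

  _≅_ : ∀ {X} → Sub X → Sub X → Set h
  S ≅ T = (S ≤ T) × (T ≤ S)

  ⊤ₛ : (∀ {A B} {f : Hom A B} → IsIso f → M f) → ∀ {X} → Sub X
  ⊤ₛ M-iso {X} = sub X id (M-iso (id , identityˡ , identityˡ))

  -- ∃_ι for ι ∈ M : image along a mono in M is the composite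
  exM : ∀ {A X} (ι : Hom A X) → (∀ {A B C'} {g : Hom B C'} {f : Hom A B} → M g → M f → M (g ∘ f)) →
        M ι → Sub A → Sub X
  exM ι M-∘ ιM S = sub (dom S) (ι ∘ arr S) (M-∘ ιM (inM S))

  module WithPullbacks (FL : FinitelyComplete) (M-pb : PullbackStable M) where
    open FinitelyComplete FL

    infixr 20 _^*_
    _^*_ : ∀ {X Y} → Hom X Y → Sub Y → Sub X
    f ^* S = sub (Pullback.P pb) (Pullback.p₁ pb) (M-pb (Pullback.isPullback pb) (inM S))
      where pb = pullback f (arr S)

    record Joins : Set (o ⊔ h ⊔ ℓ) where
      infixr 6 _∨_
      field
        ⊥ₛ    : ∀ {X} → Sub X
        ⊥-min : ∀ {X} (S : Sub X) → ⊥ₛ ≤ S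
        _∨_   : ∀ {X} → Sub X → Sub X → Sub X
        ∨-inl : ∀ {X} (S T : Sub X) → S ≤ S ∨ T
        ∨-inr : ∀ {X} (S T : Sub X) → T ≤ S ∨ T
        ∨-lub : ∀ {X} {S T U : Sub X} → S ≤ U → T ≤ U → S ∨ T ≤ U
        pb-⊥  : ∀ {X Y} (f : Hom X Y) → f ^* ⊥ₛ ≅ ⊥ₛ
        pb-∨  : ∀ {X Y} (f : Hom X Y) (S T : Sub Y) → f ^* (S ∨ T) ≅ (f ^* S) ∨ (f ^* T)

module _ {o h : Level} (C : Category o h) where
  open Category C
  open Notions C

  record FCoherent (ℓ : Level) : Set (o ⊔ h ⊔ lsuc ℓ) where
    field
      finLim     : FinitelyComplete
      M          : MorClass ℓ
      M-mono     : ∀ {A B} {m : Hom A B} → M m → Mono m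
      M-iso      : ∀ {A B} {f : Hom A B} → IsIso f → M f
      M-regular  : ∀ {A B} {f : Hom A B} → RegularMono f → M f
      M-∘        : ∀ {A B C'} {g : Hom B C'} {f : Hom A B} → M g → M f → M (g ∘ f)
      M-pullback : PullbackStable M
      factor     : ∀ {A B} (f : Hom A B) →
                   Σ[ I ∈ Obj ] Σ[ e ∈ Hom A I ] Σ[ m ∈ Hom I B ]
                     (M m × LeftOrthClass M e × m ∘ e ≡ f)
      left-pullback-stable :
                   ∀ {X Y Z P} {f : Hom X Z} {e : Hom Y Z} {p₁ : Hom P X} {p₂ : Hom P Y} →
                   IsPullback f e p₁ p₂ → LeftOrthClass M e → LeftOrthClass M p₁
      joins      : SubM.WithPullbacks.Joins C M finLim M-pullback

module _ {o h ℓ : Level} (C : Category o h) (F : FCoherent C ℓ) where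
  open Category C
  open FCoherent F
  open SubM C M
  open WithPullbacks finLim M-pullback
  open Joins joins

  record Modal : Set (o ⊔ h ⊔ ℓ) where
    field
      ◇       : ∀ {X} → Sub X → Sub X
      ◇-resp  : ∀ {X} {S T : Sub X} → S ≅ T → ◇ S ≅ ◇ T
      ◇-⊥     : ∀ {X} → ◇ (⊥ₛ {X}) ≅ ⊥ₛ
      ◇-∨     : ∀ {X} (S T : Sub X) → ◇ (S ∨ T) ≅ ◇ S ∨ ◇ T
      ◇-lax   : ∀ {X Y} (f : Hom X Y) (S : Sub Y) → ◇ (f ^* S) ≤ f ^* (◇ S)
      ◇-M     : ∀ {A X} (ι : Hom A X) (ιM : M ι) (S : Sub X) →
                ◇ (ι ^* S) ≅ ι ^* (◇ (exM ι M-∘ ιM (ι ^* S)))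

  module _ (Md : Modal) where
    open Modal Md

    record DisjointUnion (A B : Obj) : Set (o ⊔ h ⊔ ℓ) where
      field
        A+B   : Obj
        ιA    : Hom A A+B
        ιB    : Hom B A+B
        ιA-M  : M ιA
        ιB-M  : M ιB
      subA : Sub A+B
      subA = sub A ιA ιA-M
      subB : Sub A+B
      subB = sub B ιB ιB-M
      field
        meet-⊥ : ∀ (U : Sub A+B) → U ≤ subA → U ≤ subB → U ≤ ⊥ₛ
        join-⊤ : ⊤ₛ M-iso ≤ subA ∨ subB
        ◇A≤A   : ◇ subA ≤ subA
        ◇B≤B   : ◇ subB ≤ subB

    IsOpen : ∀ {X Y} → Hom X Y → Set (o ⊔ h ⊔ ℓ)
    IsOpen {Y = Y} f = ∀ (S : Sub Y) → f ^* (◇ S) ≅ ◇ (f ^* S)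

{-# OPTIONS --safe #-}
-- Write I, K for the M-subobjects A, B of A + B. Every S splits as (I ∧ S) ∨ (K ∧ S), because
-- I ∨ K = ⊤ pulls back to ⊤ along S. Hence ◇ S ≤ ◇ (I ∧ S) ∨ ◇ K ≤ ◇ (I ∧ S) ∨ K, and pulling back
-- along ι = ιA kills K (disjointness), while ι^* ◇ (I ∧ S) = ◇ ι^* S is the axiom ◇-M. So
-- ι^* ◇ S ≤ ◇ ι^* S, and the reverse inequality is laxness of ◇. Swap A and B for ιB.
module Submission where

open import Defs
open import Level using (Level; _⊔_)
open import Data.Product using (_×_; _,_; proj₁; proj₂)
open import Relation.Binary.Bundles using (Preorder)
open import Relation.Binary.PropositionalEquality as ≡ using (_≡_; refl; sym; trans; cong)
import Relation.Binary.Reasoning.Preorder as PreorderReasoning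

module SubobjectLattice {o h ℓ : Level} {C : Category o h} (F : FCoherent C ℓ) where
  open Category C
  open Notions C using (module FinitelyComplete; module Pullback; module IsPullback)
  open FCoherent F
  open SubM C M
  open WithPullbacks finLim M-pullback
  open Joins joins
  open FinitelyComplete finLim using (pullback)
  open Pullback using (p₁; p₂; isPullback)
  open IsPullback using (commute; universal)

  -- S ≤ T unfolds to a Σ-type from which Agda cannot recover S and T; wrapping it in a
  -- record keeps them inferable.
  infix 4 _⊑_
  record _⊑_ {X : Obj} (S T : Sub X) : Set h where
    constructor ⟨_⟩
    field ⊑⇒≤ : S ≤ T
  open _⊑_ public

  ⊑-refl : ∀ {X} {S : Sub X} → S ⊑ S
  ⊑-refl = ⟨ id , identityʳ ⟩

  ⊑-trans : ∀ {X} {S T U : Sub X} → S ⊑ T → T ⊑ U → S ⊑ U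
  ⊑-trans {S = S} {T} {U} ⟨ k , Tk≡S ⟩ ⟨ k' , Uk'≡T ⟩ = ⟨ k' ∘ k , (begin
      arr U ∘ (k' ∘ k)  ≡⟨ sym assoc ⟩
      (arr U ∘ k') ∘ k  ≡⟨ cong (_∘ k) Uk'≡T ⟩
      arr T ∘ k         ≡⟨ Tk≡S ⟩
      arr S             ∎) ⟩
    where open ≡.≡-Reasoning

  ⊑-preorder : Obj → Preorder (o ⊔ h ⊔ ℓ) (o ⊔ h ⊔ ℓ) h
  ⊑-preorder X = record
    { Carrier    = Sub X
    ; _≈_        = _≡_
    ; _≲_        = _⊑_
    ; isPreorder = record
      { isEquivalence = ≡.isEquivalence
      ; reflexive     = λ { refl → ⊑-refl }
      ; trans         = ⊑-trans
      }
    }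

  module ⊑-Reasoning {X : Obj} = PreorderReasoning (⊑-preorder X)

  ≅⇒⊑ : ∀ {X} {S T : Sub X} → S ≅ T → S ⊑ T
  ≅⇒⊑ S≅T = ⟨ proj₁ S≅T ⟩

  ≅⇒⊒ : ∀ {X} {S T : Sub X} → S ≅ T → T ⊑ S
  ≅⇒⊒ S≅T = ⟨ proj₂ S≅T ⟩

  top : ∀ {X} → Sub X
  top = ⊤ₛ M-iso

  ⊤-greatest : ∀ {X} {S : Sub X} → S ⊑ top
  ⊤-greatest {S = S} = ⟨ arr S , identityˡ ⟩

  ⊥-least : ∀ {X} {S : Sub X} → ⊥ₛ ⊑ S
  ⊥-least {S = S} = ⟨ ⊥-min S ⟩

  ∨-upperˡ : ∀ {X} {S T : Sub X} → S ⊑ S ∨ T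
  ∨-upperˡ {S = S} {T} = ⟨ ∨-inl S T ⟩

  ∨-upperʳ : ∀ {X} {S T : Sub X} → T ⊑ S ∨ T
  ∨-upperʳ {S = S} {T} = ⟨ ∨-inr S T ⟩

  ∨-least : ∀ {X} {S T U : Sub X} → S ⊑ U → T ⊑ U → S ∨ T ⊑ U
  ∨-least {S = S} {T} {U} ⟨ S≤U ⟩ ⟨ T≤U ⟩ = ⟨ ∨-lub {S = S} {T} {U} S≤U T≤U ⟩

  ∨-mono : ∀ {X} {S S' T T' : Sub X} → S ⊑ S' → T ⊑ T' → S ∨ T ⊑ S' ∨ T'
  ∨-mono S⊑S' T⊑T' = ∨-least (⊑-trans S⊑S' ∨-upperˡ) (⊑-trans T⊑T' ∨-upperʳ)

  ∨-comm : ∀ {X} {S T : Sub X} → S ∨ T ⊑ T ∨ S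
  ∨-comm = ∨-least ∨-upperʳ ∨-upperˡ

  ∨-identityʳ : ∀ {X} {S : Sub X} → S ∨ ⊥ₛ ⊑ S
  ∨-identityʳ = ∨-least ⊑-refl ⊥-least

  ^*-mono : ∀ {X Y} (f : Hom X Y) {S T : Sub Y} → S ⊑ T → f ^* S ⊑ f ^* T
  ^*-mono f {S} {T} ⟨ k , Tk≡S ⟩ = ⟨ proj₁ u , proj₁ (proj₁ (proj₂ u)) ⟩
    where
      pS = pullback f (arr S)
      open ≡.≡-Reasoning
      square : f ∘ p₁ pS ≡ arr T ∘ (k ∘ p₂ pS)
      square = begin
        f ∘ p₁ pS            ≡⟨ commute (isPullback pS) ⟩
        arr S ∘ p₂ pS        ≡⟨ cong (_∘ p₂ pS) (sym Tk≡S) ⟩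
        (arr T ∘ k) ∘ p₂ pS  ≡⟨ assoc ⟩
        arr T ∘ (k ∘ p₂ pS)  ∎
      u = universal (isPullback (pullback f (arr T))) (p₁ pS) (k ∘ p₂ pS) square

  ^*-∨ : ∀ {X Y} (f : Hom X Y) {S T : Sub Y} → f ^* (S ∨ T) ⊑ f ^* S ∨ f ^* T
  ^*-∨ f {S} {T} = ≅⇒⊑ (pb-∨ f S T)

  ^*-⊥ : ∀ {X Y} (f : Hom X Y) → f ^* ⊥ₛ ⊑ ⊥ₛ {X}
  ^*-⊥ f = ≅⇒⊑ (pb-⊥ f)

  infixr 20 ∃⟨_⟩_
  ∃⟨_⟩_ : ∀ {X} (I : Sub X) → Sub (dom I) → Sub X
  ∃⟨ I ⟩ T = exM (arr I) M-∘ (inM I) T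

  ∃⊑⇒⊑^* : ∀ {X} (I : Sub X) {T : Sub (dom I)} {U : Sub X} → ∃⟨ I ⟩ T ⊑ U → T ⊑ arr I ^* U
  ∃⊑⇒⊑^* I {T} {U} ⟨ k , Uk≡IT ⟩ = ⟨ proj₁ u , proj₁ (proj₁ (proj₂ u)) ⟩
    where u = universal (isPullback (pullback (arr I) (arr U))) (arr T) k (sym Uk≡IT)

  ⊑^*⇒∃⊑ : ∀ {X} (I : Sub X) {T : Sub (dom I)} {U : Sub X} → T ⊑ arr I ^* U → ∃⟨ I ⟩ T ⊑ U
  ⊑^*⇒∃⊑ I {T} {U} ⟨ k , pk≡T ⟩ = ⟨ p₂ pU ∘ k , (begin
      arr U ∘ (p₂ pU ∘ k)    ≡⟨ sym assoc ⟩
      (arr U ∘ p₂ pU) ∘ k    ≡⟨ cong (_∘ k) (sym (commute (isPullback pU))) ⟩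
      (arr I ∘ p₁ pU) ∘ k    ≡⟨ assoc ⟩
      arr I ∘ (p₁ pU ∘ k)    ≡⟨ cong (arr I ∘_) pk≡T ⟩
      arr I ∘ arr T          ∎) ⟩
    where
      pU = pullback (arr I) (arr U)
      open ≡.≡-Reasoning

  ∃-mono : ∀ {X} (I : Sub X) {T T' : Sub (dom I)} → T ⊑ T' → ∃⟨ I ⟩ T ⊑ ∃⟨ I ⟩ T'
  ∃-mono I ⟨ k , T'k≡T ⟩ = ⟨ k , trans assoc (cong (arr I ∘_) T'k≡T) ⟩

  ∃-∨ : ∀ {X} (I : Sub X) {T T' : Sub (dom I)} → ∃⟨ I ⟩ (T ∨ T') ⊑ ∃⟨ I ⟩ T ∨ ∃⟨ I ⟩ T'
  ∃-∨ I = ⊑^*⇒∃⊑ I (∨-least (∃⊑⇒⊑^* I ∨-upperˡ) (∃⊑⇒⊑^* I ∨-upperʳ))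

  infixr 7 _∧_
  _∧_ : ∀ {X} → Sub X → Sub X → Sub X
  I ∧ S = ∃⟨ I ⟩ (arr I ^* S)

  ∧-lowerˡ : ∀ {X} {I S : Sub X} → I ∧ S ⊑ I
  ∧-lowerˡ {I = I} {S} = ⟨ arr (arr I ^* S) , refl ⟩

  ∧-lowerʳ : ∀ {X} {I S : Sub X} → I ∧ S ⊑ S
  ∧-lowerʳ {I = I} = ⊑^*⇒∃⊑ I ⊑-refl

  ∧-greatest : ∀ {X} {I S U : Sub X} → U ⊑ I → U ⊑ S → U ⊑ I ∧ S
  ∧-greatest {I = I} {S} {U} ⟨ k , Ik≡U ⟩ ⟨ k' , Sk'≡U ⟩ = ⟨ proj₁ u , (begin
      (arr I ∘ p₁ pS) ∘ proj₁ u  ≡⟨ assoc ⟩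
      arr I ∘ (p₁ pS ∘ proj₁ u)  ≡⟨ cong (arr I ∘_) (proj₁ (proj₁ (proj₂ u))) ⟩
      arr I ∘ k                  ≡⟨ Ik≡U ⟩
      arr U                      ∎) ⟩
    where
      pS = pullback (arr I) (arr S)
      u = universal (isPullback pS) k k' (trans Ik≡U (sym Sk'≡U))
      open ≡.≡-Reasoning

  ∧-comm : ∀ {X} {S T : Sub X} → S ∧ T ⊑ T ∧ S
  ∧-comm = ∧-greatest ∧-lowerʳ ∧-lowerˡ

  -- S is the image of the top subobject of dom S; pull the cover back to dom S and push it
  -- forward again.
  ∧-distrib-cover : ∀ {X} {I K : Sub X} → top ⊑ I ∨ K → ∀ S → S ⊑ (I ∧ S) ∨ (K ∧ S)
  ∧-distrib-cover {I = I} {K} ⊤⊑I∨K S = begin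
    S                                        ≲⟨ ⟨ id , trans identityʳ identityʳ ⟩ ⟩
    ∃⟨ S ⟩ top                               ≲⟨ ∃-mono S ⊤⊑cover-along-S ⟩
    ∃⟨ S ⟩ (arr S ^* I ∨ arr S ^* K)         ≲⟨ ∃-∨ S ⟩
    (S ∧ I) ∨ (S ∧ K)                        ≲⟨ ∨-mono ∧-comm ∧-comm ⟩
    (I ∧ S) ∨ (K ∧ S)                        ∎
    where
      open ⊑-Reasoning
      ⊤⊑cover-along-S : top ⊑ arr S ^* I ∨ arr S ^* K
      ⊤⊑cover-along-S = ⊑-trans (∃⊑⇒⊑^* S (⊑-trans ⊤-greatest ⊤⊑I∨K)) (^*-∨ (arr S))

  ^*-disjoint : ∀ {X} {I K : Sub X} → I ∧ K ⊑ ⊥ₛ → arr I ^* K ⊑ ⊥ₛ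
  ^*-disjoint {I = I} I∧K⊑⊥ = ⊑-trans (∃⊑⇒⊑^* I I∧K⊑⊥) (^*-⊥ (arr I))

module ModalLemmas {o h ℓ : Level} {C : Category o h} {F : FCoherent C ℓ} (Md : Modal C F) where
  open FCoherent F
  open SubM C M
  open WithPullbacks finLim M-pullback
  open Joins joins
  open Modal Md
  open SubobjectLattice F

  ◇-mono : ∀ {X} {S T : Sub X} → S ⊑ T → ◇ S ⊑ ◇ T
  ◇-mono {S = S} {T} S⊑T = begin
    ◇ S        ≲⟨ ∨-upperˡ ⟩
    ◇ S ∨ ◇ T  ≲⟨ ≅⇒⊒ (◇-∨ S T) ⟩
    ◇ (S ∨ T)  ≲⟨ ≅⇒⊑ (◇-resp (⊑⇒≤ (∨-least S⊑T ⊑-refl) , ∨-inr S T)) ⟩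
    ◇ T        ∎
    where open ⊑-Reasoning

  complement-◇-closed⇒open : ∀ {X} {I K : Sub X} → I ∧ K ⊑ ⊥ₛ → top ⊑ I ∨ K → ◇ K ⊑ K →
                             IsOpen C F Md (arr I)
  complement-◇-closed⇒open {I = I} {K} I∧K⊑⊥ ⊤⊑I∨K ◇K⊑K S = ⊑⇒≤ lax⁻¹ , ◇-lax (arr I) S
    where
      open ⊑-Reasoning
      ι = arr I
      lax⁻¹ : ι ^* ◇ S ⊑ ◇ (ι ^* S)
      lax⁻¹ = begin
        ι ^* ◇ S                          ≲⟨ ^*-mono ι (◇-mono (∧-distrib-cover ⊤⊑I∨K S)) ⟩
        ι ^* ◇ ((I ∧ S) ∨ (K ∧ S))        ≲⟨ ^*-mono ι (≅⇒⊑ (◇-∨ (I ∧ S) (K ∧ S))) ⟩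
        ι ^* (◇ (I ∧ S) ∨ ◇ (K ∧ S))      ≲⟨ ^*-mono ι (∨-mono ⊑-refl (⊑-trans (◇-mono ∧-lowerˡ) ◇K⊑K)) ⟩
        ι ^* (◇ (I ∧ S) ∨ K)              ≲⟨ ^*-∨ ι ⟩
        ι ^* ◇ (I ∧ S) ∨ ι ^* K           ≲⟨ ∨-mono (≅⇒⊒ (◇-M ι (inM I) S)) (^*-disjoint I∧K⊑⊥) ⟩
        ◇ (ι ^* S) ∨ ⊥ₛ                   ≲⟨ ∨-identityʳ ⟩
        ◇ (ι ^* S)                        ∎

mainTheorem3 : ∀ {o h ℓ : Level} (C : Category o h) (F : FCoherent C ℓ) (Md : Modal C F)
                 {A B : Category.Obj C} (D : DisjointUnion C F Md A B) →
                 IsOpen C F Md (DisjointUnion.ιA D) × IsOpen C F Md (DisjointUnion.ιB D)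
mainTheorem3 C F Md D =
    complement-◇-closed⇒open {I = subA} A∧B⊑⊥ ⟨ join-⊤ ⟩ ⟨ ◇B≤B ⟩
  , complement-◇-closed⇒open {I = subB} (⊑-trans ∧-comm A∧B⊑⊥) (⊑-trans ⟨ join-⊤ ⟩ ∨-comm) ⟨ ◇A≤A ⟩
  where
    open FCoherent F using (joins)
    open SubM.WithPullbacks.Joins joins using (⊥ₛ)
    open SubobjectLattice F
    open ModalLemmas Md
    open DisjointUnion D
    A∧B⊑⊥ : subA ∧ subB ⊑ ⊥ₛ
    A∧B⊑⊥ = ⟨ meet-⊥ (subA ∧ subB) (⊑⇒≤ (∧-lowerˡ {I = subA} {subB}))
                                   (⊑⇒≤ (∧-lowerʳ {I = subA} {subB})) ⟩
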